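{- Let $(\mathcal{R},\ast,+)$ be a commutative ring and $\tau:\mathcal{R}\to\mathcal{R}$ an involutive ring homomorphism; let $\mathcal{R}^\pm$ be the eigenspaces of $\tau$ for the eigenvalues $\pm1$. Then the products $f_1\star^\pm f_2:=(f_1\pm\tau f_1)\ast(f_2\pm\tau f_2)$ are associative and satisfy $f_1\star^\pm f_2\in\mathcal{R}^+$. The bracket $[f_1,f_2]^\ast:=(\tau f_1)\ast f_2-f_1\ast(\tau f_2)$ is a Lie bracket with $[f_1,f_2]^\ast\in\mathcal{R}^-$. Moreover $\tau$ is a morphism of $\star^\pm$ and a Lie algebra morphism of $[\cdot,\cdot]^\ast$. -}

module Defs where

open import Level using (_⊔_)
open import Algebra.Bundles using (CommutativeRing)
open import Relation.Binary.Core using (_Preserves₂_⟶_⟶_)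

module _ {c ℓ} (R : CommutativeRing c ℓ) where
  open CommutativeRing R

  Eigen⁺ : (Carrier → Carrier) → Carrier → Set ℓ
  Eigen⁺ τ f = τ f ≈ f

  Eigen⁻ : (Carrier → Carrier) → Carrier → Set ℓ
  Eigen⁻ τ f = τ f ≈ - f

  star⁺ : (Carrier → Carrier) → Carrier → Carrier → Carrier
  star⁺ τ f₁ f₂ = (f₁ + τ f₁) * (f₂ + τ f₂)

  star⁻ : (Carrier → Carrier) → Carrier → Carrier → Carrier
  star⁻ τ f₁ f₂ = (f₁ + - τ f₁) * (f₂ + - τ f₂)

  bracket : (Carrier → Carrier) → Carrier → Carrier → Carrier
  bracket τ f₁ f₂ = (τ f₁ * f₂) + - (f₁ * τ f₂)

  -- A Lie bracket on the additive group of R (i.e. a Lie algebra over ℤ):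
  -- well-defined, biadditive, alternating, antisymmetric, Jacobi identity.
  record IsLieBracket (b : Carrier → Carrier → Carrier) : Set (c ⊔ ℓ) where
    field
      cong        : b Preserves₂ _≈_ ⟶ _≈_ ⟶ _≈_
      +-distribˡ  : ∀ x y z → b x (y + z) ≈ b x y + b x z
      +-distribʳ  : ∀ x y z → b (x + y) z ≈ b x z + b y z
      alternating : ∀ x → b x x ≈ 0#
      antisym     : ∀ x y → b x y ≈ - b y x
      jacobi      : ∀ x y z → (b x (b y z) + b y (b z x)) + b z (b x y) ≈ 0#

{-# OPTIONS --safe #-}
module Submission where

-- For an involution τ, π⁺ f = f + τ f is τ-invariant and π⁻ f = f − τ f is
-- τ-anti-invariant, and τ is multiplicative, so both star products land in R⁺.
-- On R⁺, π⁺ doubles and π⁻ vanishes; hence both iterated star products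
-- collapse to (twice, resp. zero times) the plain triple product, which gives
-- associativity. The bracket is sent to its negative by τ, and bracketing with
-- an element w of R⁻ is just multiplication: [f , w]* = π⁺ f * w. The Jacobi
-- identity thus becomes a cancellation of monomials in f, τ f, g, τ g, h, τ h.

open import Defs
open import Algebra.Bundles using (CommutativeRing)
open import Algebra.Definitions using (Associative)
open import Algebra.Morphism.Structures using (IsRingHomomorphism)
open import Data.Product using (_×_; _,_)
import Algebra.Properties.Ring as RingProperties
import Algebra.Properties.CommutativeSemigroup as CommutativeSemigroupProperties
import Algebra.Solver.Ring.NaturalCoefficients.Default as NaturalCoefficientsSolver
import Relation.Binary.Reasoning.Setoid as SetoidReasoning

module CommutativeRingLemmas {r ℓ} (R : CommutativeRing r ℓ) where
  open CommutativeRing R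
  open RingProperties ring using (-‿+-comm; -‿distribˡ-*; -‿distribʳ-*; -‿involutive)
  open CommutativeSemigroupProperties +-commutativeSemigroup using (interchange)
  open NaturalCoefficientsSolver commutativeSemiring using (solve; _:=_; _:+_; _:*_)
  open SetoidReasoning setoid

  -‿+-interchange : ∀ a b c d → (a + - b) + (c + - d) ≈ (a + c) + - (b + d)
  -‿+-interchange a b c d = trans (interchange a (- b) c (- d)) (+-congˡ (-‿+-comm b d))

  -x*-y≈x*y : ∀ x y → - x * - y ≈ x * y
  -x*-y≈x*y x y = begin
    - x * - y     ≈⟨ -‿distribˡ-* x (- y) ⟨
    - (x * - y)   ≈⟨ -‿cong (-‿distribʳ-* x y) ⟨
    - - (x * y)   ≈⟨ -‿involutive (x * y) ⟩
    x * y         ∎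

  -[x*-y]≈x*y : ∀ x y → - (x * - y) ≈ x * y
  -[x*-y]≈x*y x y = trans (-‿cong (sym (-‿distribʳ-* x y))) (-‿involutive (x * y))

  -- Both sides of the Jacobi identity, moved apart so that no negation occurs and the
  -- natural-coefficient solver applies; x′, y′, z′ stand for τ x, τ y, τ z.
  jacobi-monomials : ∀ x x′ y y′ z z′ →
    ((x + x′) * (y′ * z) + (y + y′) * (z′ * x)) + (z + z′) * (x′ * y) ≈
    ((x + x′) * (y * z′) + (y + y′) * (z * x′)) + (z + z′) * (x * y′)
  jacobi-monomials = solve 6 (λ x x′ y y′ z z′ →
    ((x :+ x′) :* (y′ :* z) :+ (y :+ y′) :* (z′ :* x)) :+ (z :+ z′) :* (x′ :* y) :=
    ((x :+ x′) :* (y :* z′) :+ (y :+ y′) :* (z :* x′)) :+ (z :+ z′) :* (x :* y′)) refl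

module RingInvolution {r ℓ} (R : CommutativeRing r ℓ)
  (τ : CommutativeRing.Carrier R → CommutativeRing.Carrier R)
  (τ-hom : IsRingHomomorphism (CommutativeRing.rawRing R) (CommutativeRing.rawRing R) τ)
  (τ-involutive : ∀ x → CommutativeRing._≈_ R (τ (τ x)) x)
  where

  open CommutativeRing R
  open IsRingHomomorphism τ-hom using (⟦⟧-cong; +-homo; *-homo; -‿homo)
  open RingProperties ring using (⁻¹-anti-homo‿-; x≈y⇒x∙y⁻¹≈ε; x[y-z]≈xy-xz)
  open CommutativeRingLemmas R
  open SetoidReasoning setoid

  π⁺ π⁻ : Carrier → Carrier
  π⁺ f = f + τ f
  π⁻ f = f + - τ f

  τ-neg-swap : ∀ f → τ f + - f ≈ - π⁻ f
  τ-neg-swap f = sym (⁻¹-anti-homo‿- f (τ f))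

  π⁺-eigen⁺ : ∀ f → Eigen⁺ R τ (π⁺ f)
  π⁺-eigen⁺ f = begin
    τ (f + τ f)       ≈⟨ +-homo f (τ f) ⟩
    τ f + τ (τ f)     ≈⟨ +-congˡ (τ-involutive f) ⟩
    τ f + f           ≈⟨ +-comm (τ f) f ⟩
    f + τ f           ∎

  π⁻-eigen⁻ : ∀ f → Eigen⁻ R τ (π⁻ f)
  π⁻-eigen⁻ f = begin
    τ (f + - τ f)     ≈⟨ +-homo f (- τ f) ⟩
    τ f + τ (- τ f)   ≈⟨ +-congˡ (-‿homo (τ f)) ⟩
    τ f + - τ (τ f)   ≈⟨ +-congˡ (-‿cong (τ-involutive f)) ⟩
    τ f + - f         ≈⟨ τ-neg-swap f ⟩
    - π⁻ f            ∎

  π⁺-τ : ∀ f → π⁺ (τ f) ≈ π⁺ f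
  π⁺-τ f = trans (+-congˡ (τ-involutive f)) (+-comm (τ f) f)

  π⁻-τ : ∀ f → π⁻ (τ f) ≈ - π⁻ f
  π⁻-τ f = trans (+-congˡ (-‿cong (τ-involutive f))) (τ-neg-swap f)

  π⁺-on-eigen⁺ : ∀ {p} → Eigen⁺ R τ p → π⁺ p ≈ p + p
  π⁺-on-eigen⁺ τp≈p = +-congˡ τp≈p

  π⁻-on-eigen⁺ : ∀ {p} → Eigen⁺ R τ p → π⁻ p ≈ 0#
  π⁻-on-eigen⁺ τp≈p = x≈y⇒x∙y⁻¹≈ε (sym τp≈p)

  eigen⁺-* : ∀ {a b} → Eigen⁺ R τ a → Eigen⁺ R τ b → Eigen⁺ R τ (a * b)
  eigen⁺-* {a} {b} τa≈a τb≈b = trans (*-homo a b) (*-cong τa≈a τb≈b)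

  eigen⁻-* : ∀ {a b} → Eigen⁻ R τ a → Eigen⁻ R τ b → Eigen⁺ R τ (a * b)
  eigen⁻-* {a} {b} τa≈-a τb≈-b = trans (*-homo a b) (trans (*-cong τa≈-a τb≈-b) (-x*-y≈x*y a b))

  star⁺-eigen⁺ : ∀ f g → Eigen⁺ R τ (star⁺ R τ f g)
  star⁺-eigen⁺ f g = eigen⁺-* (π⁺-eigen⁺ f) (π⁺-eigen⁺ g)

  star⁻-eigen⁺ : ∀ f g → Eigen⁺ R τ (star⁻ R τ f g)
  star⁻-eigen⁺ f g = eigen⁻-* (π⁻-eigen⁻ f) (π⁻-eigen⁻ g)

  star⁺-assoc : Associative _≈_ (star⁺ R τ)
  star⁺-assoc f g h = begin
    π⁺ (a * b) * c                ≈⟨ *-congʳ (π⁺-on-eigen⁺ (star⁺-eigen⁺ f g)) ⟩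
    (a * b + a * b) * c           ≈⟨ distribʳ c (a * b) (a * b) ⟩
    a * b * c + a * b * c         ≈⟨ +-cong (*-assoc a b c) (*-assoc a b c) ⟩
    a * (b * c) + a * (b * c)     ≈⟨ distribˡ a (b * c) (b * c) ⟨
    a * (b * c + b * c)           ≈⟨ *-congˡ (π⁺-on-eigen⁺ (star⁺-eigen⁺ g h)) ⟨
    a * π⁺ (b * c)                ∎
    where
    a b c : Carrier
    a = π⁺ f
    b = π⁺ g
    c = π⁺ h

  star⁻-assoc : Associative _≈_ (star⁻ R τ)
  star⁻-assoc f g h = begin
    π⁻ (star⁻ R τ f g) * π⁻ h     ≈⟨ *-congʳ (π⁻-on-eigen⁺ (star⁻-eigen⁺ f g)) ⟩
    0# * π⁻ h                     ≈⟨ zeroˡ (π⁻ h) ⟩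
    0#                            ≈⟨ zeroʳ (π⁻ f) ⟨
    π⁻ f * 0#                     ≈⟨ *-congˡ (π⁻-on-eigen⁺ (star⁻-eigen⁺ g h)) ⟨
    π⁻ f * π⁻ (star⁻ R τ g h)     ∎

  τ-star⁺ : ∀ f g → τ (star⁺ R τ f g) ≈ star⁺ R τ (τ f) (τ g)
  τ-star⁺ f g = trans (star⁺-eigen⁺ f g) (sym (*-cong (π⁺-τ f) (π⁺-τ g)))

  τ-star⁻ : ∀ f g → τ (star⁻ R τ f g) ≈ star⁻ R τ (τ f) (τ g)
  τ-star⁻ f g = begin
    τ (π⁻ f * π⁻ g)       ≈⟨ star⁻-eigen⁺ f g ⟩
    π⁻ f * π⁻ g           ≈⟨ -x*-y≈x*y (π⁻ f) (π⁻ g) ⟨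
    - π⁻ f * - π⁻ g       ≈⟨ *-cong (π⁻-τ f) (π⁻-τ g) ⟨
    π⁻ (τ f) * π⁻ (τ g)   ∎

  τ-bracket : ∀ f g → τ (bracket R τ f g) ≈ f * τ g + - (τ f * g)
  τ-bracket f g = begin
    τ (τ f * g + - (f * τ g))         ≈⟨ +-homo (τ f * g) (- (f * τ g)) ⟩
    τ (τ f * g) + τ (- (f * τ g))     ≈⟨ +-cong (*-homo (τ f) g) (-‿homo (f * τ g)) ⟩
    τ (τ f) * τ g + - τ (f * τ g)     ≈⟨ +-cong (*-congʳ (τ-involutive f)) (-‿cong (*-homo f (τ g))) ⟩
    f * τ g + - (τ f * τ (τ g))       ≈⟨ +-congˡ (-‿cong (*-congˡ (τ-involutive g))) ⟩
    f * τ g + - (τ f * g)             ∎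

  bracket-τ : ∀ f g → bracket R τ (τ f) (τ g) ≈ f * τ g + - (τ f * g)
  bracket-τ f g = +-cong (*-congʳ (τ-involutive f)) (-‿cong (*-congˡ (τ-involutive g)))

  τ-bracket-homo : ∀ f g → τ (bracket R τ f g) ≈ bracket R τ (τ f) (τ g)
  τ-bracket-homo f g = trans (τ-bracket f g) (sym (bracket-τ f g))

  bracket-eigen⁻ : ∀ f g → Eigen⁻ R τ (bracket R τ f g)
  bracket-eigen⁻ f g = trans (τ-bracket f g) (sym (⁻¹-anti-homo‿- (τ f * g) (f * τ g)))

  bracket-cong : ∀ {f f′ g g′} → f ≈ f′ → g ≈ g′ → bracket R τ f g ≈ bracket R τ f′ g′
  bracket-cong f≈f′ g≈g′ = +-cong (*-cong (⟦⟧-cong f≈f′) g≈g′) (-‿cong (*-cong f≈f′ (⟦⟧-cong g≈g′)))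

  bracket-distribˡ : ∀ f g h → bracket R τ f (g + h) ≈ bracket R τ f g + bracket R τ f h
  bracket-distribˡ f g h = begin
    τ f * (g + h) + - (f * τ (g + h))                    ≈⟨ +-cong (distribˡ (τ f) g h)
                                                               (-‿cong (trans (*-congˡ (+-homo g h)) (distribˡ f (τ g) (τ h)))) ⟩
    (τ f * g + τ f * h) + - (f * τ g + f * τ h)          ≈⟨ -‿+-interchange (τ f * g) (f * τ g) (τ f * h) (f * τ h) ⟨
    (τ f * g + - (f * τ g)) + (τ f * h + - (f * τ h))    ∎

  bracket-distribʳ : ∀ f g h → bracket R τ (f + g) h ≈ bracket R τ f h + bracket R τ g h
  bracket-distribʳ f g h = begin
    τ (f + g) * h + - ((f + g) * τ h)                    ≈⟨ +-cong (trans (*-congʳ (+-homo f g)) (distribʳ h (τ f) (τ g)))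
                                                               (-‿cong (distribʳ (τ h) f g)) ⟩
    (τ f * h + τ g * h) + - (f * τ h + g * τ h)          ≈⟨ -‿+-interchange (τ f * h) (f * τ h) (τ g * h) (g * τ h) ⟨
    (τ f * h + - (f * τ h)) + (τ g * h + - (g * τ h))    ∎

  bracket-alternating : ∀ f → bracket R τ f f ≈ 0#
  bracket-alternating f = x≈y⇒x∙y⁻¹≈ε (*-comm (τ f) f)

  bracket-antisym : ∀ f g → bracket R τ f g ≈ - bracket R τ g f
  bracket-antisym f g = begin
    τ f * g + - (f * τ g)       ≈⟨ ⁻¹-anti-homo‿- (f * τ g) (τ f * g) ⟨
    - (f * τ g + - (τ f * g))   ≈⟨ -‿cong (+-cong (*-comm f (τ g)) (-‿cong (*-comm (τ f) g))) ⟩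
    - (τ g * f + - (g * τ f))   ∎

  bracket-eigen⁻ʳ : ∀ f {w} → Eigen⁻ R τ w → bracket R τ f w ≈ π⁺ f * w
  bracket-eigen⁻ʳ f {w} τw≈-w = begin
    τ f * w + - (f * τ w)   ≈⟨ +-congˡ (-‿cong (*-congˡ τw≈-w)) ⟩
    τ f * w + - (f * - w)   ≈⟨ +-congˡ (-[x*-y]≈x*y f w) ⟩
    τ f * w + f * w         ≈⟨ +-comm (τ f * w) (f * w) ⟩
    f * w + τ f * w         ≈⟨ distribʳ w f (τ f) ⟨
    π⁺ f * w                ∎

  bracket-jacobi : ∀ f g h →
    (bracket R τ f (bracket R τ g h) + bracket R τ g (bracket R τ h f)) + bracket R τ h (bracket R τ f g) ≈ 0#
  bracket-jacobi f g h = begin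
    ([ f , [ g , h ] ] + [ g , [ h , f ] ]) + [ h , [ f , g ] ]
      ≈⟨ +-cong (+-cong (bracket-eigen⁻ʳ f (bracket-eigen⁻ g h)) (bracket-eigen⁻ʳ g (bracket-eigen⁻ h f)))
                (bracket-eigen⁻ʳ h (bracket-eigen⁻ f g)) ⟩
    (π⁺ f * [ g , h ] + π⁺ g * [ h , f ]) + π⁺ h * [ f , g ]
      ≈⟨ +-cong (+-cong (x[y-z]≈xy-xz (π⁺ f) (τ g * h) (g * τ h)) (x[y-z]≈xy-xz (π⁺ g) (τ h * f) (h * τ f)))
                (x[y-z]≈xy-xz (π⁺ h) (τ f * g) (f * τ g)) ⟩
    ((A₁ + - B₁) + (A₂ + - B₂)) + (A₃ + - B₃)
      ≈⟨ +-congʳ (-‿+-interchange A₁ B₁ A₂ B₂) ⟩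
    ((A₁ + A₂) + - (B₁ + B₂)) + (A₃ + - B₃)
      ≈⟨ -‿+-interchange (A₁ + A₂) (B₁ + B₂) A₃ B₃ ⟩
    ((A₁ + A₂) + A₃) + - ((B₁ + B₂) + B₃)
      ≈⟨ x≈y⇒x∙y⁻¹≈ε (jacobi-monomials f (τ f) g (τ g) h (τ h)) ⟩
    0# ∎
    where
    [_,_] : Carrier → Carrier → Carrier
    [_,_] = bracket R τ
    A₁ A₂ A₃ B₁ B₂ B₃ : Carrier
    A₁ = π⁺ f * (τ g * h)
    A₂ = π⁺ g * (τ h * f)
    A₃ = π⁺ h * (τ f * g)
    B₁ = π⁺ f * (g * τ h)
    B₂ = π⁺ g * (h * τ f)
    B₃ = π⁺ h * (f * τ g)

  bracket-isLieBracket : IsLieBracket R (bracket R τ)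
  bracket-isLieBracket = record
    { cong        = bracket-cong
    ; +-distribˡ  = bracket-distribˡ
    ; +-distribʳ  = bracket-distribʳ
    ; alternating = bracket-alternating
    ; antisym     = bracket-antisym
    ; jacobi      = bracket-jacobi
    }

mainTheorem16 : ∀ {c ℓ} (R : CommutativeRing c ℓ)
                  (τ : CommutativeRing.Carrier R → CommutativeRing.Carrier R)
                → IsRingHomomorphism (CommutativeRing.rawRing R) (CommutativeRing.rawRing R) τ
                → (∀ x → CommutativeRing._≈_ R (τ (τ x)) x)
                → let open CommutativeRing R in
                  -- ⋆⁺ and ⋆⁻ are associative
                  (Associative _≈_ (star⁺ R τ) × Associative _≈_ (star⁻ R τ))
                  -- f₁ ⋆± f₂ ∈ R⁺
                × (∀ f₁ f₂ → Eigen⁺ R τ (star⁺ R τ f₁ f₂) × Eigen⁺ R τ (star⁻ R τ f₁ f₂))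
                  -- [·,·]* is a Lie bracket with values in R⁻
                × IsLieBracket R (bracket R τ)
                × (∀ f₁ f₂ → Eigen⁻ R τ (bracket R τ f₁ f₂))
                  -- τ is a morphism of ⋆⁺ and of ⋆⁻
                × (∀ f₁ f₂ → (τ (star⁺ R τ f₁ f₂) ≈ star⁺ R τ (τ f₁) (τ f₂))
                           × (τ (star⁻ R τ f₁ f₂) ≈ star⁻ R τ (τ f₁) (τ f₂)))
                  -- τ is a Lie algebra morphism of [·,·]* (τ is additive by hypothesis)
                × (∀ f₁ f₂ → τ (bracket R τ f₁ f₂) ≈ bracket R τ (τ f₁) (τ f₂))
mainTheorem16 R τ τ-hom τ-involutive =
    (star⁺-assoc , star⁻-assoc)
  , (λ f g → star⁺-eigen⁺ f g , star⁻-eigen⁺ f g)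
  , bracket-isLieBracket
  , bracket-eigen⁻
  , (λ f g → τ-star⁺ f g , τ-star⁻ f g)
  , τ-bracket-homo
  where open RingInvolution R τ τ-hom τ-involutive
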